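{- Let $\mathcal{H}=(E,\mathscr{H})$ be a hereditary collection that has a boolean representation. Then $\mathcal{H}$ satisfies the point replacement property: for every $p\in E$ with $\{p\}\in\mathscr{H}$ and every nonempty $J\in\mathscr{H}$ there exists $x\in J$ such that $(J\setminus\{x\})\cup\{p\}\in\mathscr{H}$.
   Context: A hereditary collection is a pair $(E,\mathscr{H})$, $E$ a finite set, $\mathscr{H}\subseteq\mathcal{P}(E)$ nonempty and closed under taking subsets. The superboolean semiring $\mathbb{S}=\{0,1,1^\nu\}$ has addition $0+x=x$, $1+1=1^\nu$, $1+1^\nu=1^\nu+1^\nu=1^\nu$, and multiplication $0\cdot x=0$, $1\cdot x=x$, $1^\nu\cdot1^\nu=1^\nu$. A square matrix over $\mathbb{S}$ is nonsingular if its permanent $\sum_{\pi}\prod_i a_{\pi(i),i}$, computed in $\mathbb{S}$, equals $1$ (the empty matrix counts as nonsingular). A boolean representation of $(E,\mathscr{H})$ is a matrix $A$ with all entries in $\{0,1\}$ (regarded as elements of $\mathbb{S}$, so permanents are computed in $\mathbb{S}$, where $1+1=1^\nu$), whose columns are labeled bijectively by $E$, such that for every $X\subseteq E$: $X\in\mathscr{H}$ iff there is a set $Y$ of rows with $|Y|=|X|$ such that the submatrix $A[Y,X]$ is nonsingular. -}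

module Defs where

open import Data.Nat using (ℕ; zero; suc)
open import Data.Bool using (Bool; true; false)
open import Data.Fin using (Fin; zero; suc; punchIn)
open import Data.Fin.Subset using (Subset; inside; outside; _⊆_)
open import Data.Vec using ([]; _∷_)
open import Data.Product using (Σ; ∃; _×_)
open import Relation.Binary.PropositionalEquality using (_≡_; subst; sym)
open import Function.Bundles using (_⇔_)

data 𝕊 : Set where
  𝟘 𝟙 𝟙ν : 𝕊

infixl 6 _⊕_
infixl 7 _⊗_

_⊕_ : 𝕊 → 𝕊 → 𝕊
𝟘 ⊕ y = y
𝟙 ⊕ 𝟘 = 𝟙
𝟙 ⊕ 𝟙 = 𝟙ν
𝟙 ⊕ 𝟙ν = 𝟙ν
𝟙ν ⊕ _ = 𝟙ν

_⊗_ : 𝕊 → 𝕊 → 𝕊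
𝟘 ⊗ _ = 𝟘
𝟙 ⊗ y = y
𝟙ν ⊗ 𝟘 = 𝟘
𝟙ν ⊗ 𝟙 = 𝟙ν
𝟙ν ⊗ 𝟙ν = 𝟙ν

fromBool : Bool → 𝕊
fromBool false = 𝟘
fromBool true = 𝟙

Σ𝕊 : ∀ {k} → (Fin k → 𝕊) → 𝕊
Σ𝕊 {zero} f = 𝟘
Σ𝕊 {suc k} f = f zero ⊕ Σ𝕊 (λ i → f (suc i))

-- permanent of a k×k matrix over 𝕊 (M row col), computed by expansion
-- along the first column; equals Σ_π Π_i M (π i) i. Empty matrix: 𝟙.
perm : ∀ {k} → (Fin k → Fin k → 𝕊) → 𝕊
perm {zero} M = 𝟙
perm {suc k} M = Σ𝕊 (λ i → M i zero ⊗ perm (λ r c → M (punchIn i r) (suc c)))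

Nonsingular : ∀ {k} → (Fin k → Fin k → 𝕊) → Set
Nonsingular M = perm M ≡ 𝟙

size : ∀ {n} → Subset n → ℕ
size [] = zero
size (inside ∷ p) = suc (size p)
size (outside ∷ p) = size p

elem : ∀ {n} (p : Subset n) → Fin (size p) → Fin n
elem (inside ∷ p) zero = zero
elem (inside ∷ p) (suc i) = suc (elem p i)
elem (outside ∷ p) i = suc (elem p i)

record Hereditary (n : ℕ) (H : Subset n → Set) : Set where
  field
    nonempty : ∃ λ X → H X
    closed   : ∀ X Y → Y ⊆ X → H X → H Y

sub : ∀ {m n} → (Fin m → Fin n → Bool) → (Y : Subset m) → (X : Subset n) →
      size Y ≡ size X → Fin (size X) → Fin (size X) → 𝕊
sub A Y X eq r c = fromBool (A (elem Y (subst Fin (sym eq) r)) (elem X c))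

IsBoolRep : ∀ {m n} → (Fin m → Fin n → Bool) → (Subset n → Set) → Set
IsBoolRep {m} A H = ∀ X → H X ⇔ (Σ (Subset m) λ Y → Σ (size Y ≡ size X) λ eq → Nonsingular (sub A Y X eq))

HasBoolRep : ∀ {n} → (Subset n → Set) → Set
HasBoolRep {n} H = Σ ℕ λ m → Σ (Fin m → Fin n → Bool) λ A → IsBoolRep A H

-- Over 𝕊 the permanent of a 0/1 matrix counts its transversals, saturating at 1ν ("at least two"),
-- so H X holds iff for some row set Y the bipartite graph of A between Y and X has a unique perfect
-- matching. In such a matching some row is adjacent to only one column of X: otherwise, moving from
-- each column to another neighbour of its matched row eventually closes a cycle, and rotating the
-- matching along that cycle gives a second one. Now let p ∉ J. If no row of Y sees p, trade any
-- column of J and its row for p and a row seeing p. If the degree-one row sees p, hand it p instead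
-- of its column. Otherwise delete that row and its column, recurse, and put them back. In each case
-- the new edge is used by every perfect matching of the new pair, which keeps the matching unique.

module Submission where

open import Defs
open import Data.Nat using (ℕ; zero; suc; _+_; _∸_; _≤_)
open import Data.Nat.Properties using (1+n≰n; +-comm; +-suc; n<1+n; m∸n+n≡m)
import Data.Nat.Properties as ℕ
open import Data.Nat.GeneralisedArithmetic using (fold; fold-+)
open import Data.Bool using (Bool; true; false)
open import Data.Bool.Properties using () renaming (_≟_ to _≟ᵇ_)
open import Data.Fin using (Fin; zero; suc; toℕ; punchIn; punchOut)
open import Data.Fin.Properties
  using ( _≟_; any?; all?; 0≢1+n; suc-injective; punchIn-injective; punchInᵢ≢i; punchIn-punchOut
        ; injective⇒≤; pigeonhole)
open import Data.Fin.Subset using (Subset; inside; outside; _∈_; _∉_; _⊆_; _∪_; _─_; _-_; ⁅_⁆; Nonempty)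
open import Data.Fin.Subset.Properties
  using (_∈?_; x∈⁅x⁆; x∈⁅y⁆⇒x≡y; x∈p∪q⁻; x∈p∪q⁺; x∈p∧x≢y⇒x∈p-y; p─q⊆p; p─⊥≡p; p─x─y≡p─y─x; ⊆-antisym)
open import Data.Vec using (_∷_; here; there)
open import Data.Vec.Functional using (updateAt)
open import Data.Vec.Functional.Properties using (updateAt-updates; updateAt-minimal)
open import Data.Product using (Σ; ∃; ∃₂; _×_; _,_; proj₁; proj₂)
open import Data.Sum using (_⊎_; inj₁; inj₂)
open import Data.Empty using (⊥-elim)
open import Function using (_∘_; _∘′_; const)
open import Function.Bundles using (Equivalence)
open import Function.Definitions using (Injective)
open import Relation.Nullary using (¬_; yes; no; contradiction)
open import Relation.Nullary.Decidable using (_×-dec_; _→-dec_; ¬?; decidable-stable)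
open import Relation.Binary.PropositionalEquality
  using (_≡_; _≢_; _≗_; refl; sym; trans; cong; subst; subst₂; module ≡-Reasoning)
open import Relation.Binary.PropositionalEquality.Properties using (subst-injective; subst-sym-subst)
open ≡-Reasoning

-- Sums and permanents over 𝕊

⊕≡𝟘 : ∀ x y → x ⊕ y ≡ 𝟘 → x ≡ 𝟘 × y ≡ 𝟘
⊕≡𝟘 𝟘 y e = refl , e
⊕≡𝟘 𝟙 𝟘 ()
⊕≡𝟘 𝟙 𝟙 ()
⊕≡𝟘 𝟙 𝟙ν ()
⊕≡𝟘 𝟙ν y ()

⊕≡𝟙 : ∀ x y → x ⊕ y ≡ 𝟙 → (x ≡ 𝟙 × y ≡ 𝟘) ⊎ (x ≡ 𝟘 × y ≡ 𝟙)
⊕≡𝟙 𝟘 y e = inj₂ (refl , e)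
⊕≡𝟙 𝟙 𝟘 e = inj₁ (refl , refl)
⊕≡𝟙 𝟙 𝟙 ()
⊕≡𝟙 𝟙 𝟙ν ()
⊕≡𝟙 𝟙ν y ()

fromBool⊗≡𝟙 : ∀ b y → fromBool b ⊗ y ≡ 𝟙 → b ≡ true × y ≡ 𝟙
fromBool⊗≡𝟙 true y e = refl , e

Σ𝕊≡𝟘⇒ : ∀ {k} (f : Fin k → 𝕊) → Σ𝕊 f ≡ 𝟘 → ∀ i → f i ≡ 𝟘
Σ𝕊≡𝟘⇒ f e zero    = proj₁ (⊕≡𝟘 _ _ e)
Σ𝕊≡𝟘⇒ f e (suc i) = Σ𝕊≡𝟘⇒ (λ i → f (suc i)) (proj₂ (⊕≡𝟘 _ _ e)) i

Σ𝕊≡𝟘⇐ : ∀ {k} (f : Fin k → 𝕊) → (∀ i → f i ≡ 𝟘) → Σ𝕊 f ≡ 𝟘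
Σ𝕊≡𝟘⇐ {zero}  f h = refl
Σ𝕊≡𝟘⇐ {suc k} f h rewrite h zero = Σ𝕊≡𝟘⇐ (λ i → f (suc i)) (λ i → h (suc i))

SoleOne : ∀ {k} → (Fin k → 𝕊) → Fin k → Set
SoleOne f i = f i ≡ 𝟙 × (∀ j → j ≢ i → f j ≡ 𝟘)

Σ𝕊≡𝟙⇒ : ∀ {k} (f : Fin k → 𝕊) → Σ𝕊 f ≡ 𝟙 → ∃ (SoleOne f)
Σ𝕊≡𝟙⇒ {suc k} f e with ⊕≡𝟙 _ _ e
... | inj₁ (f0 , rest) = zero , f0 , λ where
  zero    0≢0 → ⊥-elim (0≢0 refl)
  (suc j) _   → Σ𝕊≡𝟘⇒ (λ i → f (suc i)) rest j
... | inj₂ (f0 , rest) with Σ𝕊≡𝟙⇒ (λ i → f (suc i)) rest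
...   | i , fi , others = suc i , fi , λ where
  zero    _   → f0
  (suc j) j≢i → others j (λ j≡i → j≢i (cong suc j≡i))

Σ𝕊≡𝟙⇐ : ∀ {k} (f : Fin k → 𝕊) {i} → SoleOne f i → Σ𝕊 f ≡ 𝟙
Σ𝕊≡𝟙⇐ {suc k} f {zero} (f0 , others)
  rewrite f0 | Σ𝕊≡𝟘⇐ (λ i → f (suc i)) (λ j → others (suc j) λ ()) = refl
Σ𝕊≡𝟙⇐ {suc k} f {suc i} (fi , others) rewrite others zero (λ ()) =
  Σ𝕊≡𝟙⇐ (λ i → f (suc i)) (fi , λ j j≢i → others (suc j) (λ sj≡si → j≢i (suc-injective sj≡si)))

Transversal : ∀ {k} → (Fin k → Fin k → Bool) → (Fin k → Fin k) → Set
Transversal M π = (∀ c → M (π c) c ≡ true) × Injective _≡_ _≡_ π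

UniqueTransversal : ∀ {k} → (Fin k → Fin k → Bool) → Set
UniqueTransversal M = Σ _ λ π → Transversal M π × (∀ π′ → Transversal M π′ → π′ ≗ π)

permB : ∀ {k} → (Fin k → Fin k → Bool) → 𝕊
permB M = perm (λ r c → fromBool (M r c))

minor : ∀ {k} → (Fin (suc k) → Fin (suc k) → Bool) → Fin (suc k) → Fin k → Fin k → Bool
minor M i r c = M (punchIn i r) (suc c)

-- permB M unfolds definitionally to Σ𝕊 (expansionTerm M).
expansionTerm : ∀ {k} → (Fin (suc k) → Fin (suc k) → Bool) → Fin (suc k) → 𝕊
expansionTerm M i = fromBool (M i zero) ⊗ permB (minor M i)

extendFirst : ∀ {k} → Fin (suc k) → (Fin k → Fin k) → Fin (suc k) → Fin (suc k)
extendFirst i ρ zero    = i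
extendFirst i ρ (suc c) = punchIn i (ρ c)

dropFirst : ∀ {k} (π : Fin (suc k) → Fin (suc k)) → Injective _≡_ _≡_ π → Fin k → Fin k
dropFirst π inj c = punchOut {i = π zero} {j = π (suc c)} (λ π0≡πc → 0≢1+n (inj π0≡πc))

extendFirst-dropFirst : ∀ {k} (π : Fin (suc k) → Fin (suc k)) (inj : Injective _≡_ _≡_ π) →
                        extendFirst (π zero) (dropFirst π inj) ≗ π
extendFirst-dropFirst π inj zero    = refl
extendFirst-dropFirst π inj (suc c) = punchIn-punchOut _

extendFirst-transversal : ∀ {k} {M : Fin (suc k) → Fin (suc k) → Bool} {i ρ} →
                          M i zero ≡ true → Transversal (minor M i) ρ → Transversal M (extendFirst i ρ)
extendFirst-transversal {M = M} {i} {ρ} Mi0 (hit , inj) = hit′ , inj′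
  where
  hit′ : ∀ c → M (extendFirst i ρ c) c ≡ true
  hit′ zero    = Mi0
  hit′ (suc c) = hit c
  inj′ : Injective _≡_ _≡_ (extendFirst i ρ)
  inj′ {zero}  {zero}  _ = refl
  inj′ {zero}  {suc y} q = ⊥-elim (punchInᵢ≢i i (ρ y) (sym q))
  inj′ {suc x} {zero}  q = ⊥-elim (punchInᵢ≢i i (ρ x) q)
  inj′ {suc x} {suc y} q = cong suc (inj (punchIn-injective i _ _ q))

dropFirst-transversal : ∀ {k} {M : Fin (suc k) → Fin (suc k) → Bool} {π} →
                        (t : Transversal M π) → Transversal (minor M (π zero)) (dropFirst π (proj₂ t))
dropFirst-transversal {M = M} {π} (hit , inj) = hit′ , λ q → suc-injective (inj (dropFirst-injective q))
  where
  hit′ : ∀ c → M (punchIn (π zero) (dropFirst π inj c)) (suc c) ≡ true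
  hit′ c rewrite extendFirst-dropFirst π inj (suc c) = hit (suc c)
  dropFirst-injective : ∀ {x y} → dropFirst π inj x ≡ dropFirst π inj y → π (suc x) ≡ π (suc y)
  dropFirst-injective {x} {y} q = trans (sym (extendFirst-dropFirst π inj (suc x)))
    (trans (cong (punchIn (π zero)) q) (extendFirst-dropFirst π inj (suc y)))

mutual
  perm≡𝟘⇒noTransversal : ∀ {k} (M : Fin k → Fin k → Bool) → permB M ≡ 𝟘 → ∀ π → ¬ Transversal M π
  perm≡𝟘⇒noTransversal {suc k} M e π = term≡𝟘⇒noTransversal M π (Σ𝕊≡𝟘⇒ (expansionTerm M) e (π zero))

  term≡𝟘⇒noTransversal : ∀ {k} (M : Fin (suc k) → Fin (suc k) → Bool) π →
                         expansionTerm M (π zero) ≡ 𝟘 → ¬ Transversal M π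
  term≡𝟘⇒noTransversal M π e t@(hit , _) rewrite hit zero =
    perm≡𝟘⇒noTransversal (minor M (π zero)) e _ (dropFirst-transversal {M = M} t)

mutual
  noTransversal⇒perm≡𝟘 : ∀ {k} (M : Fin k → Fin k → Bool) → (∀ π → ¬ Transversal M π) → permB M ≡ 𝟘
  noTransversal⇒perm≡𝟘 {zero}  M none = ⊥-elim (none (λ ()) ((λ ()) , λ {}))
  noTransversal⇒perm≡𝟘 {suc k} M none =
    Σ𝕊≡𝟘⇐ (expansionTerm M) (λ j → unextendable⇒term≡𝟘 M j (λ ρ → none (extendFirst j ρ)))

  unextendable⇒term≡𝟘 : ∀ {k} (M : Fin (suc k) → Fin (suc k) → Bool) j →
    (∀ ρ → ¬ Transversal M (extendFirst j ρ)) → expansionTerm M j ≡ 𝟘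
  unextendable⇒term≡𝟘 M j none with M j zero in Mj0
  ... | false = refl
  ... | true
    rewrite noTransversal⇒perm≡𝟘 (minor M j) (λ ρ t → none ρ (extendFirst-transversal {M = M} Mj0 t)) = refl

extendFirst-cong : ∀ {k} (i : Fin (suc k)) {ρ ρ′} → ρ ≗ ρ′ → extendFirst i ρ ≗ extendFirst i ρ′
extendFirst-cong i ρ≗ρ′ zero    = refl
extendFirst-cong i ρ≗ρ′ (suc c) = cong (punchIn i) (ρ≗ρ′ c)

perm≡𝟙⇒uniqueTransversal : ∀ {k} (M : Fin k → Fin k → Bool) → permB M ≡ 𝟙 → UniqueTransversal M
perm≡𝟙⇒uniqueTransversal {zero} M e = (λ ()) , ((λ ()) , λ {}) , λ _ _ ()
perm≡𝟙⇒uniqueTransversal {suc k} M e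
  with i , termᵢ≡𝟙 , others ← Σ𝕊≡𝟙⇒ (expansionTerm M) e
  with Mi0 , minor≡𝟙 ← fromBool⊗≡𝟙 (M i zero) _ termᵢ≡𝟙
  with ρ , tρ , uniqueρ ← perm≡𝟙⇒uniqueTransversal (minor M i) minor≡𝟙
  = extendFirst i ρ , extendFirst-transversal {M = M} Mi0 tρ , unique
  where
  unique : ∀ π → Transversal M π → π ≗ extendFirst i ρ
  unique π t@(_ , inj) c with π zero ≟ i
  ... | no π0≢i = ⊥-elim (term≡𝟘⇒noTransversal M π (others (π zero) π0≢i) t)
  ... | yes refl = trans (sym (extendFirst-dropFirst π inj c))
                         (extendFirst-cong i (uniqueρ _ (dropFirst-transversal {M = M} t)) c)

uniqueTransversal⇒perm≡𝟙 : ∀ {k} (M : Fin k → Fin k → Bool) → UniqueTransversal M → permB M ≡ 𝟙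
uniqueTransversal⇒perm≡𝟙 {zero}  M _ = refl
uniqueTransversal⇒perm≡𝟙 {suc k} M (π , t@(hit , inj) , unique) =
  Σ𝕊≡𝟙⇐ (expansionTerm M) (termπ0≡𝟙 , others)
  where
  minorUnique : UniqueTransversal (minor M (π zero))
  minorUnique = dropFirst π inj , dropFirst-transversal {M = M} t , λ ρ tρ c →
    punchIn-injective (π zero) _ _ (trans (unique _ (extendFirst-transversal {M = M} (hit zero) tρ) (suc c))
                                          (sym (extendFirst-dropFirst π inj (suc c))))
  termπ0≡𝟙 : expansionTerm M (π zero) ≡ 𝟙
  termπ0≡𝟙 rewrite hit zero = uniqueTransversal⇒perm≡𝟙 _ minorUnique
  others : ∀ j → j ≢ π zero → expansionTerm M j ≡ 𝟘
  others j j≢π0 = unextendable⇒term≡𝟘 M j (λ ρ tρ → j≢π0 (unique _ tρ zero))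

-- Finite sets

elem∈ : ∀ {n} (X : Subset n) c → elem X c ∈ X
elem∈ (inside ∷ X) zero    = here
elem∈ (inside ∷ X) (suc c) = there (elem∈ X c)
elem∈ (outside ∷ X) c      = there (elem∈ X c)

index : ∀ {n} (X : Subset n) {j} → j ∈ X → Fin (size X)
index (inside ∷ X)  here      = zero
index (inside ∷ X)  (there p) = suc (index X p)
index (outside ∷ X) (there p) = index X p

elem-index : ∀ {n} (X : Subset n) {j} (p : j ∈ X) → elem X (index X p) ≡ j
elem-index (inside ∷ X)  here      = refl
elem-index (inside ∷ X)  (there p) = cong suc (elem-index X p)
elem-index (outside ∷ X) (there p) = cong suc (elem-index X p)

index-elem : ∀ {n} (X : Subset n) c {j} (p : j ∈ X) → elem X c ≡ j → index X p ≡ c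
index-elem (inside ∷ X)  zero    here      refl = refl
index-elem (inside ∷ X)  (suc c) (there p) refl = cong suc (index-elem X c p refl)
index-elem (outside ∷ X) c       (there p) refl = index-elem X c p refl

elem-injective : ∀ {n} (X : Subset n) → Injective _≡_ _≡_ (elem X)
elem-injective X {a} {b} e = trans (sym (index-elem X a (elem∈ X b) e)) (index-elem X b (elem∈ X b) refl)

x∈p─q⇒x∉q : ∀ {n} (p q : Subset n) {x} → x ∈ p ─ q → x ∉ q
x∈p─q⇒x∉q (inside ∷ p) (outside ∷ q) here      ()
x∈p─q⇒x∉q (_ ∷ p)      (_ ∷ q)       (there x) (there y) = x∈p─q⇒x∉q p q x y

x∈p-y⁻ : ∀ {n} {p : Subset n} {x y} → x ∈ p - y → x ∈ p × x ≢ y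
x∈p-y⁻ {p = p} {y = y} x∈ = p─q⊆p p ⁅ y ⁆ x∈ , λ { refl → x∈p─q⇒x∉q p ⁅ y ⁆ x∈ (x∈⁅x⁆ y) }

x∈p∪⁅y⁆⁻ : ∀ {n} {p : Subset n} {x y} → x ∈ p ∪ ⁅ y ⁆ → x ∈ p ⊎ x ≡ y
x∈p∪⁅y⁆⁻ {p = p} {y = y} x∈ with x∈p∪q⁻ p ⁅ y ⁆ x∈
... | inj₁ x∈p = inj₁ x∈p
... | inj₂ x∈y = inj₂ (x∈⁅y⁆⇒x≡y y x∈y)

x∈p⇒x∈p∪⁅y⁆ : ∀ {n} {p : Subset n} {x y} → x ∈ p → x ∈ p ∪ ⁅ y ⁆
x∈p⇒x∈p∪⁅y⁆ x∈p = x∈p∪q⁺ (inj₁ x∈p)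

y∈p∪⁅y⁆ : ∀ {n} {p : Subset n} y → y ∈ p ∪ ⁅ y ⁆
y∈p∪⁅y⁆ y = x∈p∪q⁺ (inj₂ (x∈⁅x⁆ y))

y∉p⇒p∪⁅y⁆-y≡p : ∀ {n} {p : Subset n} {y} → y ∉ p → (p ∪ ⁅ y ⁆) - y ≡ p
y∉p⇒p∪⁅y⁆-y≡p {p = p} {y} y∉p = ⊆-antisym ⊆p p⊆
  where
  ⊆p : (p ∪ ⁅ y ⁆) - y ⊆ p
  ⊆p x∈ with x∈p-y⁻ x∈
  ... | x∈p∪y , x≢y with x∈p∪⁅y⁆⁻ x∈p∪y
  ...   | inj₁ x∈p = x∈p
  ...   | inj₂ x≡y = contradiction x≡y x≢y
  p⊆ : p ⊆ (p ∪ ⁅ y ⁆) - y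
  p⊆ x∈p = x∈p∧x≢y⇒x∈p-y (x∈p⇒x∈p∪⁅y⁆ x∈p) (λ { refl → y∉p x∈p })

size-minus : ∀ {n} (Y : Subset n) {y} → y ∈ Y → size Y ≡ suc (size (Y - y))
size-minus (inside ∷ Y)  here      = cong (suc ∘ size) (sym (p─⊥≡p Y))
size-minus (inside ∷ Y)  (there p) = cong suc (size-minus Y p)
size-minus (outside ∷ Y) (there p) = size-minus Y p

x≢y⇒p∪⁅x⁆-y≡p-y∪⁅x⁆ : ∀ {n} {p : Subset n} {x y} → x ≢ y → (p ∪ ⁅ x ⁆) - y ≡ (p - y) ∪ ⁅ x ⁆
x≢y⇒p∪⁅x⁆-y≡p-y∪⁅x⁆ {p = p} {x} {y} x≢y = ⊆-antisym ⊆right ⊆left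
  where
  ⊆right : (p ∪ ⁅ x ⁆) - y ⊆ (p - y) ∪ ⁅ x ⁆
  ⊆right c∈ with x∈p-y⁻ c∈
  ... | c∈p∪x , c≢y with x∈p∪⁅y⁆⁻ c∈p∪x
  ...   | inj₁ c∈p  = x∈p⇒x∈p∪⁅y⁆ (x∈p∧x≢y⇒x∈p-y c∈p c≢y)
  ...   | inj₂ refl = y∈p∪⁅y⁆ x
  ⊆left : (p - y) ∪ ⁅ x ⁆ ⊆ (p ∪ ⁅ x ⁆) - y
  ⊆left c∈ with x∈p∪⁅y⁆⁻ c∈
  ... | inj₁ c∈p-y = let c∈p , c≢y = x∈p-y⁻ c∈p-y in x∈p∧x≢y⇒x∈p-y (x∈p⇒x∈p∪⁅y⁆ c∈p) c≢y
  ... | inj₂ refl  = x∈p∧x≢y⇒x∈p-y (y∈p∪⁅y⁆ x) x≢y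

x∈p⇒p-x∪⁅x⁆⊆p : ∀ {n} {p : Subset n} {x} → x ∈ p → (p - x) ∪ ⁅ x ⁆ ⊆ p
x∈p⇒p-x∪⁅x⁆⊆p x∈p y∈ with x∈p∪⁅y⁆⁻ y∈
... | inj₁ y∈p-x = proj₁ (x∈p-y⁻ y∈p-x)
... | inj₂ refl  = x∈p

updateAt-const-cases : ∀ {a} {A : Set a} {n} (f : Fin n → A) j y c →
  c ≡ j × updateAt f j (const y) c ≡ y ⊎ c ≢ j × updateAt f j (const y) c ≡ f c
updateAt-const-cases f j y c with c ≟ j
... | yes refl = inj₁ (refl , updateAt-updates j f)
... | no c≢j   = inj₂ (c≢j , updateAt-minimal c j f c≢j)

eventuallyPeriodic : ∀ {n} (g : Fin n → Fin n) x → ∃₂ λ a k → fold (fold x g a) g (suc k) ≡ fold x g a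
eventuallyPeriodic {n} g x with pigeonhole (n<1+n n) (λ t → fold x g (toℕ t))
... | i , j , i<j , orbitᵢ≡orbitⱼ = a , k , (begin
    fold (fold x g a) g (suc k)  ≡⟨ fold-+ x g (suc k) ⟨
    fold x g (suc k + a)         ≡⟨ cong (fold x g) (trans (sym (+-suc k a)) (m∸n+n≡m i<j)) ⟩
    fold x g (toℕ j)             ≡⟨ orbitᵢ≡orbitⱼ ⟨
    fold x g a                   ∎)
  where
  a = toℕ i
  k = toℕ j ∸ suc a

-- Matchings in the bipartite graph of a 0/1 matrix

module Bipartite {m n : ℕ} (A : Fin m → Fin n → Bool) where

  -- f j is the row matched to column j; the values of f outside X are irrelevant.
  record Matching (Y : Subset m) (X : Subset n) (f : Fin n → Fin m) : Set where
    field
      maps-into : ∀ {j} → j ∈ X → f j ∈ Y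
      adjacent  : ∀ {j} → j ∈ X → A (f j) j ≡ true
      injective : ∀ {i j} → i ∈ X → j ∈ X → f i ≡ f j → i ≡ j

  Unique : Subset m → Subset n → (Fin n → Fin m) → Set
  Unique Y X f = ∀ {g} → Matching Y X g → ∀ {j} → j ∈ X → g j ≡ f j

  record UniquePerfectMatching (Y : Subset m) (X : Subset n) : Set where
    field
      sameSize : size Y ≡ size X
      match    : Fin n → Fin m
      matching : Matching Y X match
      unique   : Unique Y X match

  restrict : ∀ {Y X f j} → Matching Y X f → j ∈ X → Matching (Y - f j) (X - j) f
  restrict {f = f} μ j∈X = record
    { maps-into = λ c∈ → let c∈X , c≢j = x∈p-y⁻ c∈ in
                    x∈p∧x≢y⇒x∈p-y (maps-into c∈X) (c≢j ∘ injective c∈X j∈X)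
    ; adjacent  = adjacent ∘ proj₁ ∘ x∈p-y⁻
    ; injective = λ a∈ b∈ → injective (proj₁ (x∈p-y⁻ a∈)) (proj₁ (x∈p-y⁻ b∈))
    }
    where open Matching μ

  extend : ∀ {Y X f y j} → Matching (Y - y) (X - j) f → y ∈ Y → A y j ≡ true →
           Matching Y X (updateAt f j (const y))
  extend {Y} {X} {f} {y} {j} μ y∈Y Ayj = record
    { maps-into = maps-into′ ; adjacent = adjacent′ ; injective = injective′ }
    where
    open Matching μ
    f′ : Fin n → Fin m
    f′ = updateAt f j (const y)
    maps-into′ : ∀ {c} → c ∈ X → f′ c ∈ Y
    maps-into′ {c} c∈X with updateAt-const-cases f j y c
    ... | inj₁ (refl , f′c≡y) rewrite f′c≡y = y∈Y
    ... | inj₂ (c≢j , f′c≡fc) rewrite f′c≡fc =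
          proj₁ (x∈p-y⁻ (maps-into (x∈p∧x≢y⇒x∈p-y c∈X c≢j)))
    adjacent′ : ∀ {c} → c ∈ X → A (f′ c) c ≡ true
    adjacent′ {c} c∈X with updateAt-const-cases f j y c
    ... | inj₁ (refl , f′c≡y) rewrite f′c≡y = Ayj
    ... | inj₂ (c≢j , f′c≡fc) rewrite f′c≡fc = adjacent (x∈p∧x≢y⇒x∈p-y c∈X c≢j)
    fc≢y : ∀ {c} → c ∈ X → c ≢ j → f c ≢ y
    fc≢y c∈X c≢j = proj₂ (x∈p-y⁻ (maps-into (x∈p∧x≢y⇒x∈p-y c∈X c≢j)))
    injective′ : ∀ {a b} → a ∈ X → b ∈ X → f′ a ≡ f′ b → a ≡ b
    injective′ {a} {b} a∈X b∈X eq with updateAt-const-cases f j y a | updateAt-const-cases f j y b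
    ... | inj₁ (refl , ea) | inj₁ (refl , eb) = refl
    ... | inj₁ (refl , ea) | inj₂ (b≢j , eb) =
          contradiction (trans (sym eb) (trans (sym eq) ea)) (fc≢y b∈X b≢j)
    ... | inj₂ (a≢j , ea) | inj₁ (refl , eb) =
          contradiction (trans (sym ea) (trans eq eb)) (fc≢y a∈X a≢j)
    ... | inj₂ (a≢j , ea) | inj₂ (b≢j , eb) =
          injective (x∈p∧x≢y⇒x∈p-y a∈X a≢j) (x∈p∧x≢y⇒x∈p-y b∈X b≢j) (trans (sym ea) (trans eq eb))

  surjective : ∀ {Y X f} → Matching Y X f → size Y ≡ size X →
               ∀ {y} → y ∈ Y → ∃ λ j → j ∈ X × f j ≡ y
  surjective {Y} {X} {f} μ sizeY≡sizeX {y} y∈Y with any? (λ j → (j ∈? X) ×-dec (f j ≟ y))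
  ... | yes hit  = hit
  ... | no miss = contradiction (injective⇒≤ (λ {a} {b} → into-injective a b)) X≰Y-y
    where
    open Matching μ
    into∈ : ∀ c → f (elem X c) ∈ Y - y
    into∈ c = x∈p∧x≢y⇒x∈p-y (maps-into (elem∈ X c)) (λ fc≡y → miss (elem X c , elem∈ X c , fc≡y))
    into : Fin (size X) → Fin (size (Y - y))
    into c = index (Y - y) (into∈ c)
    into-injective : ∀ a b → into a ≡ into b → a ≡ b
    into-injective a b e = elem-injective X (injective (elem∈ X a) (elem∈ X b)
      (trans (sym (elem-index (Y - y) (into∈ a)))
             (trans (cong (elem (Y - y)) e) (elem-index (Y - y) (into∈ b)))))
    X≰Y-y : ¬ size X ≤ size (Y - y)
    X≰Y-y rewrite sym sizeY≡sizeX | size-minus Y y∈Y = 1+n≰n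

  OnlyNeighbour : Subset n → Fin m → Fin n → Set
  OnlyNeighbour X y j = ∀ {c} → c ∈ X → A y c ≡ true → c ≡ j

  -- The size premise restricts attention to perfect matchings.
  Forced : Subset m → Subset n → Fin m → Fin n → Set
  Forced Y X y j = size Y ≡ size X → ∀ {g} → Matching Y X g → g j ≡ y

  forcedByRow : ∀ {Y X y j} → y ∈ Y → OnlyNeighbour X y j → Forced Y X y j
  forcedByRow {y = y} y∈Y only sizeY≡sizeX {g} ν with surjective ν sizeY≡sizeX y∈Y
  ... | c , c∈X , gc≡y =
    subst (λ c → g c ≡ y) (only c∈X (subst (λ z → A z c ≡ true) gc≡y (Matching.adjacent ν c∈X))) gc≡y

  forcedByColumn : ∀ {Y X y j} → j ∈ X → (∀ {z} → z ∈ Y → A z j ≡ true → z ≡ y) → Forced Y X y j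
  forcedByColumn j∈X only _ ν = only (Matching.maps-into ν j∈X) (Matching.adjacent ν j∈X)

  restrictUnique : ∀ {Y X} (u : UniquePerfectMatching Y X) {j} → j ∈ X →
    UniquePerfectMatching (Y - UniquePerfectMatching.match u j) (X - j)
  restrictUnique {Y} {X} u {j} j∈X = record
    { sameSize = ℕ.suc-injective
        (trans (sym (size-minus Y (maps-into j∈X))) (trans sameSize (size-minus X j∈X)))
    ; match    = match
    ; matching = restrict matching j∈X
    ; unique   = λ {g} ν c∈ → let c∈X , c≢j = x∈p-y⁻ c∈ in
        trans (sym (updateAt-minimal _ j g c≢j)) (unique (extend ν (maps-into j∈X) (adjacent j∈X)) c∈X)
    }
    where
    open UniquePerfectMatching u
    open Matching matching

  insertForced : ∀ {Y X y j} → y ∈ Y → j ∈ X → A y j ≡ true → Forced Y X y j →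
                 UniquePerfectMatching (Y - y) (X - j) → UniquePerfectMatching Y X
  insertForced {Y} {X} {y} {j} y∈Y j∈X Ayj forced u = record
    { sameSize = sameSize′
    ; match    = updateAt match j (const y)
    ; matching = extend matching y∈Y Ayj
    ; unique   = unique′
    }
    where
    open UniquePerfectMatching u
    sameSize′ : size Y ≡ size X
    sameSize′ = trans (size-minus Y y∈Y) (trans (cong suc sameSize) (sym (size-minus X j∈X)))
    unique′ : Unique Y X (updateAt match j (const y))
    unique′ {g} ν {c} c∈X with updateAt-const-cases match j y c
    ... | inj₁ (refl , e) = trans (forced sameSize′ ν) (sym e)
    ... | inj₂ (c≢j , e)  = trans (unique ν′ (x∈p∧x≢y⇒x∈p-y c∈X c≢j)) (sym e)
      where
      ν′ : Matching (Y - y) (X - j) g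
      ν′ = subst (λ z → Matching (Y - z) (X - j) g) (forced sameSize′ ν) (restrict ν j∈X)

  -- g c is another neighbour of the row matched to c. On the points of a g-cycle, giving each column
  -- the row of its predecessor is again a matching, so uniqueness forces every g-cycle to be trivial.
  module Rotation {Y X f} (μ : Matching Y X f) (uniqueF : Unique Y X f)
                  (g : Fin n → Fin n) (g∈X : ∀ {c} → c ∈ X → g c ∈ X)
                  (adjacent-g : ∀ {c} → c ∈ X → A (f c) (g c) ≡ true) where

    open Matching μ

    fold∈X : ∀ t {c} → c ∈ X → fold c g t ∈ X
    fold∈X zero    c∈X = c∈X
    fold∈X (suc t) c∈X = g∈X (fold∈X t c∈X)

    shorterPeriod : ∀ k {x} → x ∈ X → fold x g (suc (suc k)) ≡ x → fold x g (suc k) ≡ x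
    shorterPeriod k {x} x∈X x-periodic = injective (fold∈X (suc k) x∈X) x∈X fpre≡fx
      where
      period : ℕ
      period = suc (suc k)
      pre : Fin n → Fin n
      pre c = fold c g (suc k)
      Periodic : Fin n → Set
      Periodic c = fold c g period ≡ c
      pre-periodic : ∀ {c} → Periodic c → Periodic (pre c)
      pre-periodic {c} c-periodic = begin
        fold (fold c g (suc k)) g period ≡⟨ fold-+ c g period ⟨
        fold c g (period + suc k)         ≡⟨ cong (fold c g) (+-comm period (suc k)) ⟩
        fold c g (suc k + period)         ≡⟨ fold-+ c g (suc k) ⟩
        fold (fold c g period) g (suc k)  ≡⟨ cong (λ z → fold z g (suc k)) c-periodic ⟩
        fold c g (suc k)                  ∎
      rotated : Fin n → Fin m
      rotated c with fold c g period ≟ c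
      ... | yes _ = f (pre c)
      ... | no _  = f c
      rotated-cases : ∀ c → Periodic c × rotated c ≡ f (pre c) ⊎ ¬ Periodic c × rotated c ≡ f c
      rotated-cases c with fold c g period ≟ c
      ... | yes c-periodic = inj₁ (c-periodic , refl)
      ... | no ¬c-periodic = inj₂ (¬c-periodic , refl)
      rotation : Matching Y X rotated
      rotation = record { maps-into = maps-into′ ; adjacent = adjacent′ ; injective = injective′ }
        where
        maps-into′ : ∀ {c} → c ∈ X → rotated c ∈ Y
        maps-into′ {c} c∈X with rotated-cases c
        ... | inj₁ (_ , e) rewrite e = maps-into (fold∈X (suc k) c∈X)
        ... | inj₂ (_ , e) rewrite e = maps-into c∈X
        adjacent′ : ∀ {c} → c ∈ X → A (rotated c) c ≡ true
        adjacent′ {c} c∈X with rotated-cases c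
        ... | inj₁ (c-periodic , e) rewrite e =
              subst (λ z → A (f (pre c)) z ≡ true) c-periodic (adjacent-g (fold∈X (suc k) c∈X))
        ... | inj₂ (_ , e) rewrite e = adjacent c∈X
        injective′ : ∀ {a b} → a ∈ X → b ∈ X → rotated a ≡ rotated b → a ≡ b
        injective′ {a} {b} a∈X b∈X eq with rotated-cases a | rotated-cases b
        ... | inj₁ (pa , ea) | inj₁ (pb , eb) =
              trans (sym pa) (trans (cong g (injective (fold∈X (suc k) a∈X) (fold∈X (suc k) b∈X)
                (trans (sym ea) (trans eq eb)))) pb)
        ... | inj₁ (pa , ea) | inj₂ (¬pb , eb) = contradiction
              (subst Periodic (injective (fold∈X (suc k) a∈X) b∈X (trans (sym ea) (trans eq eb)))
                     (pre-periodic pa)) ¬pb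
        ... | inj₂ (¬pa , ea) | inj₁ (pb , eb) = contradiction
              (subst Periodic (injective (fold∈X (suc k) b∈X) a∈X (trans (sym eb) (trans (sym eq) ea)))
                     (pre-periodic pb)) ¬pa
        ... | inj₂ (_ , ea) | inj₂ (_ , eb) = injective a∈X b∈X (trans (sym ea) (trans eq eb))
      fpre≡fx : f (pre x) ≡ f x
      fpre≡fx with rotated-cases x
      ... | inj₁ (_ , e) = trans (sym e) (uniqueF rotation x∈X)
      ... | inj₂ (¬x-periodic , _) = contradiction x-periodic ¬x-periodic

    periodic⇒fixed : ∀ k {x} → x ∈ X → fold x g (suc k) ≡ x → g x ≡ x
    periodic⇒fixed zero    x∈X e = e
    periodic⇒fixed (suc k) x∈X e = periodic⇒fixed k x∈X (shorterPeriod k x∈X e)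

  degreeOneRow : ∀ {Y X f} → Matching Y X f → Unique Y X f → ∀ {j₀} → j₀ ∈ X →
                 ∃ λ j → j ∈ X × OnlyNeighbour X (f j) j
  degreeOneRow {Y} {X} {f} μ uniqueF {j₀} j₀∈X
    with any? (λ j → (j ∈? X) ×-dec all? (λ c → (c ∈? X) →-dec ((A (f j) c ≟ᵇ true) →-dec (c ≟ j))))
  ... | yes (j , j∈X , only) = j , j∈X , λ c∈X Ajc → only _ c∈X Ajc
  ... | no none = let a , k , periodic = eventuallyPeriodic g j₀
                      x∈X = fold∈X a j₀∈X
                  in ⊥-elim (proj₂ (proj₂ (g-spec x∈X)) (periodic⇒fixed k x∈X periodic))
    where
    other : ∀ {j} → j ∈ X → ∃ λ c → c ∈ X × A (f j) c ≡ true × c ≢ j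
    other {j} j∈X with any? (λ c → (c ∈? X) ×-dec (A (f j) c ≟ᵇ true) ×-dec ¬? (c ≟ j))
    ... | yes found  = found
    ... | no nothing = contradiction (j , j∈X , λ c c∈X Ajc →
            decidable-stable (c ≟ j) (λ c≢j → nothing (c , c∈X , Ajc , c≢j))) none
    g : Fin n → Fin n
    g j with j ∈? X
    ... | yes j∈X = proj₁ (other j∈X)
    ... | no _    = j
    g-spec : ∀ {j} → j ∈ X → g j ∈ X × A (f j) (g j) ≡ true × g j ≢ j
    g-spec {j} j∈X with j ∈? X
    ... | yes j∈X′ = proj₂ (other j∈X′)
    ... | no j∉X   = contradiction j∈X j∉X
    open Rotation μ uniqueF g (proj₁ ∘ g-spec) (proj₁ ∘ proj₂ ∘ g-spec)

  exchangeAtDegreeOneRow : ∀ {Y X p j} (u : UniquePerfectMatching Y X) → p ∉ X → j ∈ X →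
    let y = UniquePerfectMatching.match u j in
    OnlyNeighbour X y j → A y p ≡ true → UniquePerfectMatching Y ((X - j) ∪ ⁅ p ⁆)
  exchangeAtDegreeOneRow {Y} {X} {p} {j} u p∉X j∈X only Ayp =
    insertForced y∈Y (y∈p∪⁅y⁆ p) Ayp (forcedByRow y∈Y only′)
      (subst (UniquePerfectMatching (Y - y)) (sym (y∉p⇒p∪⁅y⁆-y≡p (p∉X ∘ proj₁ ∘ x∈p-y⁻)))
        (restrictUnique u j∈X))
    where
    open UniquePerfectMatching u
    y : Fin m
    y = match j
    y∈Y : y ∈ Y
    y∈Y = Matching.maps-into matching j∈X
    only′ : OnlyNeighbour ((X - j) ∪ ⁅ p ⁆) y p
    only′ c∈ Ayc with x∈p∪⁅y⁆⁻ c∈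
    ... | inj₁ c∈X-j = let c∈X , c≢j = x∈p-y⁻ c∈X-j in contradiction (only c∈X Ayc) c≢j
    ... | inj₂ c≡p   = c≡p

  exchangeThroughOutsideRow : ∀ {Y X p r j} (u : UniquePerfectMatching Y X) → p ∉ X →
    (∀ {z} → z ∈ Y → A z p ≢ true) → A r p ≡ true → j ∈ X →
    UniquePerfectMatching ((Y - UniquePerfectMatching.match u j) ∪ ⁅ r ⁆) ((X - j) ∪ ⁅ p ⁆)
  exchangeThroughOutsideRow {Y} {X} {p} {r} {j} u p∉X noNeighbour Arp j∈X =
    insertForced (y∈p∪⁅y⁆ r) (y∈p∪⁅y⁆ p) Arp (forcedByColumn (y∈p∪⁅y⁆ p) only)
      (subst₂ UniquePerfectMatching (sym (y∉p⇒p∪⁅y⁆-y≡p r∉Y-y))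
                                    (sym (y∉p⇒p∪⁅y⁆-y≡p (p∉X ∘ proj₁ ∘ x∈p-y⁻)))
        (restrictUnique u j∈X))
    where
    open UniquePerfectMatching u
    r∉Y-y : r ∉ Y - match j
    r∉Y-y r∈ = noNeighbour (proj₁ (x∈p-y⁻ r∈)) Arp
    only : ∀ {z} → z ∈ (Y - match j) ∪ ⁅ r ⁆ → A z p ≡ true → z ≡ r
    only z∈ Azp with x∈p∪⁅y⁆⁻ z∈
    ... | inj₁ z∈Y-y = contradiction Azp (noNeighbour (proj₁ (x∈p-y⁻ z∈Y-y)))
    ... | inj₂ z≡r   = z≡r

  open UniquePerfectMatching using (sameSize; match; matching; unique)

  exchangeSameRows : ∀ k {Y X p y} → size X ≡ k → UniquePerfectMatching Y X →
                     p ∉ X → y ∈ Y → A y p ≡ true →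
                     ∃ λ x → x ∈ X × UniquePerfectMatching Y ((X - x) ∪ ⁅ p ⁆)
  exchangeSameRows k {Y} {X} {p} {y} size≡k u p∉X y∈Y Ayp
    with j₀ , j₀∈X , _ ← surjective (matching u) (sameSize u) y∈Y
    with j , j∈X , only ← degreeOneRow (matching u) (unique u) j₀∈X
    with A (match u j) p ≟ᵇ true | k
  ... | yes Ajp | _ = j , j∈X , exchangeAtDegreeOneRow u p∉X j∈X only Ajp
  ... | no ¬Ajp | zero  = contradiction (trans (sym size≡k) (size-minus X j∈X)) ℕ.0≢1+n
  ... | no ¬Ajp | suc k′
    with x , x∈X-j , u′ ← exchangeSameRows k′ (ℕ.suc-injective (trans (sym (size-minus X j∈X)) size≡k))
                            (restrictUnique u j∈X) (p∉X ∘ proj₁ ∘ x∈p-y⁻)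
                            (x∈p∧x≢y⇒x∈p-y y∈Y (λ { refl → ¬Ajp Ayp })) Ayp
    = x , x∈X , insertForced (maps-into j∈X) j∈X′ (adjacent j∈X) (forcedByRow (maps-into j∈X) only′)
                  (subst (UniquePerfectMatching (Y - match u j)) X′-j≡ u′)
    where
    open Matching (matching u)
    x∈X : x ∈ X
    x∈X = proj₁ (x∈p-y⁻ x∈X-j)
    j∈X′ : j ∈ (X - x) ∪ ⁅ p ⁆
    j∈X′ = x∈p⇒x∈p∪⁅y⁆ (x∈p∧x≢y⇒x∈p-y j∈X (λ { refl → proj₂ (x∈p-y⁻ x∈X-j) refl }))
    X′-j≡ : ((X - j) - x) ∪ ⁅ p ⁆ ≡ ((X - x) ∪ ⁅ p ⁆) - j
    X′-j≡ = sym (trans (x≢y⇒p∪⁅x⁆-y≡p-y∪⁅x⁆ (λ { refl → p∉X j∈X }))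
                       (cong (_∪ ⁅ p ⁆) (p─x─y≡p─y─x X x j)))
    only′ : OnlyNeighbour ((X - x) ∪ ⁅ p ⁆) (match u j) j
    only′ c∈ Ajc with x∈p∪⁅y⁆⁻ c∈
    ... | inj₁ c∈X-x = only (proj₁ (x∈p-y⁻ c∈X-x)) Ajc
    ... | inj₂ refl  = contradiction Ajc ¬Ajp

-- Submatrices and boolean representations

module SubmatrixMatchings {m n} (A : Fin m → Fin n → Bool) (Y : Subset m) (X : Subset n)
                          (eq : size Y ≡ size X) where

  open Bipartite A

  row : Fin (size X) → Fin m
  row r = elem Y (subst Fin (sym eq) r)

  rowIndex : ∀ {y} → y ∈ Y → Fin (size X)
  rowIndex y∈Y = subst Fin eq (index Y y∈Y)

  row-rowIndex : ∀ {y} (y∈Y : y ∈ Y) → row (rowIndex y∈Y) ≡ y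
  row-rowIndex y∈Y = trans (cong (elem Y) (subst-sym-subst {P = Fin} eq)) (elem-index Y y∈Y)

  row-injective : ∀ {r s} → row r ≡ row s → r ≡ s
  row-injective e = subst-injective {P = Fin} (sym eq) (elem-injective Y e)

  submatrix : Fin (size X) → Fin (size X) → Bool
  submatrix r c = A (row r) (elem X c)

  fromTransversal : Fin m → (Fin (size X) → Fin (size X)) → Fin n → Fin m
  fromTransversal default π j with j ∈? X
  ... | yes j∈X = row (π (index X j∈X))
  ... | no _    = default

  fromTransversal-elem : ∀ default π c → fromTransversal default π (elem X c) ≡ row (π c)
  fromTransversal-elem default π c with elem X c ∈? X
  ... | yes c∈X = cong (row ∘′ π) (index-elem X c c∈X refl)
  ... | no c∉X  = contradiction (elem∈ X c) c∉X

  fromTransversal-∈ : ∀ default π {j} (j∈X : j ∈ X) →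
                      fromTransversal default π j ≡ row (π (index X j∈X))
  fromTransversal-∈ default π j∈X =
    trans (cong (fromTransversal default π) (sym (elem-index X j∈X))) (fromTransversal-elem default π _)

  transversal⇒matching : ∀ default {π} → Transversal submatrix π →
                         Matching Y X (fromTransversal default π)
  transversal⇒matching default {π} (hit , inj) = record
    { maps-into = λ j∈X → subst (_∈ Y) (sym (fromTransversal-∈ default π j∈X)) (elem∈ Y _)
    ; adjacent  = λ {j} j∈X → subst₂ (λ y c → A y c ≡ true)
                    (sym (fromTransversal-∈ default π j∈X)) (elem-index X j∈X) (hit (index X j∈X))
    ; injective = λ i∈X j∈X e → trans (sym (elem-index X i∈X)) (trans (cong (elem X) (inj (row-injective
                    (trans (sym (fromTransversal-∈ default π i∈X))
                           (trans e (fromTransversal-∈ default π j∈X))))))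
                    (elem-index X j∈X))
    }

  toTransversal : ∀ {f} → Matching Y X f → Fin (size X) → Fin (size X)
  toTransversal μ c = rowIndex (Matching.maps-into μ (elem∈ X c))

  row-toTransversal : ∀ {f} (μ : Matching Y X f) c → row (toTransversal μ c) ≡ f (elem X c)
  row-toTransversal μ c = row-rowIndex _

  matching⇒transversal : ∀ {f} (μ : Matching Y X f) → Transversal submatrix (toTransversal μ)
  matching⇒transversal {f} μ = hit , λ {a} {b} e → elem-injective X (injective (elem∈ X a) (elem∈ X b)
    (trans (sym (row-toTransversal μ a)) (trans (cong row e) (row-toTransversal μ b))))
    where
    open Matching μ
    hit : ∀ c → submatrix (toTransversal μ c) c ≡ true
    hit c rewrite row-toTransversal μ c = adjacent (elem∈ X c)

  uniqueTransversal⇒uniquePerfectMatching : Fin m → UniqueTransversal submatrix →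
                                            UniquePerfectMatching Y X
  uniqueTransversal⇒uniquePerfectMatching default (π , t , uniqueπ) = record
    { sameSize = eq
    ; match    = fromTransversal default π
    ; matching = transversal⇒matching default t
    ; unique   = λ {g} μ {j} j∈X → begin
        g j                                  ≡⟨ cong g (elem-index X j∈X) ⟨
        g (elem X (index X j∈X))             ≡⟨ row-toTransversal μ _ ⟨
        row (toTransversal μ (index X j∈X))  ≡⟨ cong row (uniqueπ _ (matching⇒transversal μ) _) ⟩
        row (π (index X j∈X))                ≡⟨ fromTransversal-∈ default π j∈X ⟨
        fromTransversal default π j          ∎
    }

  uniquePerfectMatching⇒uniqueTransversal : ∀ {f} → Matching Y X f → Unique Y X f →
                                            UniqueTransversal submatrix
  uniquePerfectMatching⇒uniqueTransversal {f} μ uniqueF =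
    toTransversal μ , matching⇒transversal μ , λ π′ t′ c → row-injective (begin
      row (π′ c)                                    ≡⟨ fromTransversal-elem (f (elem X c)) π′ c ⟨
      fromTransversal (f (elem X c)) π′ (elem X c)  ≡⟨ uniqueF (transversal⇒matching _ t′) (elem∈ X c) ⟩
      f (elem X c)                                  ≡⟨ row-toTransversal μ c ⟨
      row (toTransversal μ c)                       ∎)

module _ {m n} (A : Fin m → Fin n → Bool) where
  open Bipartite A

  nonsingular⇒uniquePerfectMatching : ∀ {Y X j} eq → j ∈ X → Nonsingular (sub A Y X eq) →
                                      UniquePerfectMatching Y X
  nonsingular⇒uniquePerfectMatching {Y} {X} eq j∈X nonsingular =
    uniqueTransversal⇒uniquePerfectMatching (row (index X j∈X))
      (perm≡𝟙⇒uniqueTransversal submatrix nonsingular)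
    where open SubmatrixMatchings A Y X eq

  uniquePerfectMatching⇒nonsingular : ∀ {Y X} (u : UniquePerfectMatching Y X) →
                                      Nonsingular (sub A Y X (UniquePerfectMatching.sameSize u))
  uniquePerfectMatching⇒nonsingular {Y} {X} u = uniqueTransversal⇒perm≡𝟙 submatrix
    (uniquePerfectMatching⇒uniqueTransversal matching unique)
    where
    open UniquePerfectMatching u
    open SubmatrixMatchings A Y X sameSize

module BooleanRepresentation {m n} (A : Fin m → Fin n → Bool) {H : Subset n → Set}
                             (represents : IsBoolRep A H) where
  open Bipartite A

  H⇒uniquePerfectMatching : ∀ {X j} → H X → j ∈ X → ∃ λ Y → UniquePerfectMatching Y X
  H⇒uniquePerfectMatching HX j∈X = let Y , eq , nonsingular = Equivalence.to (represents _) HX in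
    Y , nonsingular⇒uniquePerfectMatching A eq j∈X nonsingular

  uniquePerfectMatching⇒H : ∀ {Y X} → UniquePerfectMatching Y X → H X
  uniquePerfectMatching⇒H u = Equivalence.from (represents _)
    (_ , UniquePerfectMatching.sameSize u , uniquePerfectMatching⇒nonsingular A u)

  replacePoint : ∀ {p J j₀} → H ⁅ p ⁆ → H J → j₀ ∈ J → p ∉ J →
                 ∃ λ x → x ∈ J × H ((J - x) ∪ ⁅ p ⁆)
  replacePoint {p} {J} {j₀} H⁅p⁆ HJ j₀∈J p∉J
    with Y , uJ ← H⇒uniquePerfectMatching HJ j₀∈J
    with any? (λ y → (y ∈? Y) ×-dec (A y p ≟ᵇ true))
  ... | yes (y , y∈Y , Ayp) =
        let x , x∈J , u = exchangeSameRows _ refl uJ p∉J y∈Y Ayp in x , x∈J , uniquePerfectMatching⇒H u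
  ... | no noNeighbour = j₀ , j₀∈J , uniquePerfectMatching⇒H
        (exchangeThroughOutsideRow uJ p∉J (λ z∈Y Azp → noNeighbour (_ , z∈Y , Azp)) Arp j₀∈J)
    where
    u⁅p⁆ : UniquePerfectMatching _ ⁅ p ⁆
    u⁅p⁆ = proj₂ (H⇒uniquePerfectMatching H⁅p⁆ (x∈⁅x⁆ p))
    Arp : A (UniquePerfectMatching.match u⁅p⁆ p) p ≡ true
    Arp = Matching.adjacent (UniquePerfectMatching.matching u⁅p⁆) (x∈⁅x⁆ p)

theorem5p3 : (n : ℕ) (H : Subset n → Set) → Hereditary n H → HasBoolRep H →
    (p : Fin n) → H ⁅ p ⁆ → (J : Subset n) → Nonempty J → H J →
    Σ (Fin n) λ x → x ∈ J × H ((J - x) ∪ ⁅ p ⁆)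
theorem5p3 n H hereditary (m , A , represents) p H⁅p⁆ J (j₀ , j₀∈J) HJ with p ∈? J
... | yes p∈J = p , p∈J , Hereditary.closed hereditary J _ (x∈p⇒p-x∪⁅x⁆⊆p p∈J) HJ
... | no p∉J  = BooleanRepresentation.replacePoint A represents H⁅p⁆ HJ j₀∈J p∉J
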